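{- Every clear single-coalition-first neighborhood model $z$-represents a clear grand-coalition-first action model; that is, for every clear single-coalition-first neighborhood model $N$ there is a clear grand-coalition-first action model $M$ that is $z$-representable by $N$.
   Context: $AG$ is a finite nonempty set of agents, $AP$ a countable set of atomic propositions. For a nonempty set $AC$ and $C\subseteq AG$, $JA_C$ is the set of functions $\sigma_C:C\to AC$ ($JA_\emptyset=\{\emptyset\}$); $\sigma_C\subseteq\sigma_{AG}$ means $\sigma_C$ is the restriction of $\sigma_{AG}$ to $C$. A grand-coalition-first action model is $M=(ST,AC,out_{AG},L)$ with $ST,AC$ nonempty, $out_{AG}:ST\times JA_{AG}\to\mathcal P(ST)$, $L:ST\to\mathcal P(AP)$. It determines $out_C(s,\sigma_C)=\bigcup\{out_{AG}(s,\sigma_{AG})\mid\sigma_C\subseteq\sigma_{AG}\}$, $av_C(s)=\{\sigma_C\mid out_C(s,\sigma_C)\neq\emptyset\}$, and $AE_C(s)=\{out_C(s,\sigma_C)\mid\sigma_C\in av_C(s)\}$. $M$ is clear if for all $s$ and $\sigma_{AG}\neq\sigma'_{AG}$, $out_{AG}(s,\sigma_{AG})\cap out_{AG}(s,\sigma'_{AG})=\emptyset$. A single-coalition-first neighborhood model is $N=(ST,suc,\{nei_a\}_{a\in AG},L)$ with $ST$ nonempty, $suc:ST\to\mathcal P(ST)$, $L:ST\to\mathcal P(AP)$, each $nei_a(s)\subseteq\mathcal P(ST)$ a cover of $suc(s)$ (union $suc(s)$, $\emptyset\notin nei_a(s)$). With $\Delta_1\odot\Delta_2=\{Y_1\cap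 Y_2\mid Y_i\in\Delta_i,Y_1\cap Y_2\neq\emptyset\}$ (extended to finitely many families, $\bigodot\{\Delta\}=\Delta$): $nei_C(s)=\emptyset$ if $suc(s)=\emptyset$; $\{suc(s)\}$ if $suc(s)\neq\emptyset$, $C=\emptyset$; $\bigodot\{nei_a(s)\mid a\in C\}$ otherwise. $N$ is clear if for all $a,s$, $nei_a(s)$ is a partition of $suc(s)$. $M$ is $z$-representable by $N$ ($N$ $z$-represents $M$) if they share $ST$ and $L$ and $AE_C=nei_C$ for all $C\subseteq AG$. -}

module Defs where

open import Level using (Level; _⊔_; 0ℓ; Lift) renaming (suc to lsuc)
open import Data.Nat using (ℕ)
open import Data.Fin using (Fin)
open import Data.Fin.Subset using (Subset; _∈_)
open import Data.Fin.Subset.Properties using (_∈?_)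
open import Data.List using (List; []; _∷_; filter; allFin)
open import Data.Product using (Σ; ∃; _×_; _,_)
open import Relation.Binary.Bundles using (Setoid)
open import Relation.Binary.PropositionalEquality using (_≡_)
open import Relation.Nullary using (¬_)

_≐_ : {A : Set} {a b : Level} → (A → Set a) → (A → Set b) → Set (a ⊔ b)
X ≐ Y = ∀ u → (X u → Y u) × (Y u → X u)

_∩_ : {A : Set} {a b : Level} → (A → Set a) → (A → Set b) → A → Set (a ⊔ b)
(X ∩ Y) u = X u × Y u

NonEmpty : {A : Set} {a : Level} → (A → Set a) → Set a
NonEmpty {A} X = Σ A X

Family : Set → Set₂
Family ST = (ST → Set) → Set₁

⋃ : {ST : Set} → Family ST → ST → Set₁
⋃ Δ u = ∃ λ X → Δ X × X u

_≋_ : {ST : Set} {a a' b b' : Level} →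
      ((ST → Set a) → Set a') → ((ST → Set b) → Set b') →
      Set (lsuc a ⊔ a' ⊔ lsuc b ⊔ b')
Δ ≋ Δ' = (∀ X → Δ X → ∃ λ Y → Δ' Y × (X ≐ Y))
       × (∀ Y → Δ' Y → ∃ λ X → Δ X × (X ≐ Y))

members : {n : ℕ} → Subset n → List (Fin n)
members {n} C = filter (_∈? C) (allFin n)

-- Grand-coalition-first action models.
-- The action set AC is a setoid (a set with its equality), since actions
-- needed here are subsets of ST, whose equality is extensional.

record ActionModel (n : ℕ) (ST AP : Set) : Set₃ where
  field
    AC     : Setoid (lsuc 0ℓ) 0ℓ
  open Setoid AC public renaming (Carrier to Act; _≈_ to _≈ᴬ_)
  field
    st₀    : ST
    act₀   : Act
    outAG  : ST → (Fin n → Act) → ST → Set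
    outAG-resp : ∀ s σ σ' → (∀ a → σ a ≈ᴬ σ' a) → outAG s σ ≐ outAG s σ'
    L      : ST → AP → Set

  JA : Subset n → Set₁
  JA C = (a : Fin n) → a ∈ C → Act

  _⊑_ : {C : Subset n} → JA C → (Fin n → Act) → Set
  _⊑_ {C} σC σ = ∀ a (p : a ∈ C) → σC a p ≈ᴬ σ a

  outC : (C : Subset n) → ST → JA C → ST → Set₁
  outC C s σC t = ∃ λ (σ : Fin n → Act) → (σC ⊑ σ) × outAG s σ t

  av : (C : Subset n) → ST → JA C → Set₁
  av C s σC = NonEmpty (outC C s σC)

  AE : (C : Subset n) → ST → (ST → Set₁) → Set₁
  AE C s X = ∃ λ (σC : JA C) → av C s σC × (X ≐ outC C s σC)

IsClearAM : {n : ℕ} {ST AP : Set} → ActionModel n ST AP → Set₁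
IsClearAM {n} M = ∀ s (σ σ' : Fin n → Act) → ¬ (∀ a → σ a ≈ᴬ σ' a) →
                  ¬ NonEmpty (outAG s σ ∩ outAG s σ')
  where open ActionModel M

_⊙_ : {ST : Set} → Family ST → Family ST → Family ST
(Δ₁ ⊙ Δ₂) Z = ∃ λ Y₁ → ∃ λ Y₂ → Δ₁ Y₁ × Δ₂ Y₂ × NonEmpty (Y₁ ∩ Y₂) × (Z ≐ (Y₁ ∩ Y₂))

⨀ : {ST : Set} → Family ST → List (Family ST) → Family ST
⨀ Δ []        = Δ
⨀ Δ (Δ' ∷ Δs) = Δ ⊙ ⨀ Δ' Δs

record NbhdModel (n : ℕ) (ST AP : Set) : Set₂ where
  field
    st₀  : ST
    sucᴺ : ST → ST → Set
    nei  : Fin n → ST → Family ST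
    L    : ST → AP → Set
    nei-union : ∀ a s → ⋃ (nei a s) ≐ sucᴺ s
    nei-nonempty : ∀ a s X → nei a s X → NonEmpty X

  neiCoal : (C : Subset n) → ST → Family ST
  neiCoal C s Y with members C
  ... | []     = Lift (lsuc 0ℓ) (NonEmpty (sucᴺ s) × (Y ≐ sucᴺ s))
  ... | a ∷ as = NonEmpty (sucᴺ s) × ⨀ (nei a s) (Data.List.map (λ b → nei b s) as) Y

-- partition: a cover whose blocks are pairwise equal or disjoint
IsClearNM : {n : ℕ} {ST AP : Set} → NbhdModel n ST AP → Set₁
IsClearNM N = ∀ a s X Y → nei a s X → nei a s Y → NonEmpty (X ∩ Y) → X ≐ Y
  where open NbhdModel N

ZRepresents : {n : ℕ} {ST AP : Set} → NbhdModel n ST AP → ActionModel n ST AP → Set₂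
ZRepresents N M = (ActionModel.L M ≡ NbhdModel.L N)
                × (∀ C s → ActionModel.AE M C s ≋ NbhdModel.neiCoal N C s)

{-# OPTIONS --safe #-}
module Submission where

-- Take as actions the blocks of the partitions nei_b(s), and let a joint action σ lead
-- from s to the states lying in every block σ(b).  Because each nei_b(s) partitions
-- suc(s), both AE_C(s) and nei_C(s) turn out to be the family of C-cells of s: the sets
-- of states of suc(s) sharing with a fixed u ∈ suc(s) their nei_b(s)-block for all b ∈ C.

open import Defs
open import Data.Nat using (ℕ; suc)
open import Data.Product using (Σ; ∃; _×_; _,_; proj₁; proj₂)
open import Level using (Level; Lift; lift; 0ℓ) renaming (suc to lsuc)
open import Data.Fin using (Fin; zero)
open import Data.Fin.Subset using (Subset; _∈_)
open import Data.Fin.Subset.Properties using (_∈?_)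
open import Data.List using ([]; _∷_; map; allFin)
open import Data.List.Membership.Propositional using () renaming (_∈_ to _∈ˡ_)
open import Data.List.Membership.Propositional.Properties using (∈-filter⁺; ∈-filter⁻; ∈-allFin)
open import Data.List.Relation.Unary.Any using (here; there)
open import Data.List.Relation.Unary.Any.Properties using (¬Any[])
open import Data.Maybe using (Maybe; just; nothing)
open import Data.Empty using (⊥; ⊥-elim)
open import Data.Unit using (⊤; tt)
open import Relation.Nullary using (yes; no)
open import Relation.Binary.Bundles using (Setoid)
open import Relation.Binary.PropositionalEquality using (_≡_; refl; sym; trans)

private
  variable
    A ST : Set
    a b c a′ b′ c′ : Level

≐-refl : {X : A → Set a} → X ≐ X
≐-refl u = (λ x → x) , (λ x → x)

≐-sym : {X : A → Set a} {Y : A → Set b} → X ≐ Y → Y ≐ X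
≐-sym e u = proj₂ (e u) , proj₁ (e u)

≐-trans : {X : A → Set a} {Y : A → Set b} {Z : A → Set c} → X ≐ Y → Y ≐ Z → X ≐ Z
≐-trans e f u = (λ x → proj₁ (f u) (proj₁ (e u) x)) , (λ z → proj₂ (e u) (proj₂ (f u) z))

∩-cong : {X : A → Set a} {X′ : A → Set a′} {Y : A → Set b} {Y′ : A → Set b′} →
         X ≐ X′ → Y ≐ Y′ → (X ∩ Y) ≐ (X′ ∩ Y′)
∩-cong e f u = (λ { (x , y) → proj₁ (e u) x , proj₁ (f u) y })
             , (λ { (x , y) → proj₂ (e u) x , proj₂ (f u) y })

≋-sym : {Δ : (ST → Set a) → Set a′} {Δ′ : (ST → Set b) → Set b′} → Δ ≋ Δ′ → Δ′ ≋ Δ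
≋-sym (to , from) =
    (λ Y dY → let (X , dX , e) = from Y dY in X , dX , ≐-sym e)
  , (λ X dX → let (Y , dY , e) = to X dX in Y , dY , ≐-sym e)

≋-trans : {Δ : (ST → Set a) → Set a′} {Δ′ : (ST → Set b) → Set b′}
          {Δ″ : (ST → Set c) → Set c′} → Δ ≋ Δ′ → Δ′ ≋ Δ″ → Δ ≋ Δ″
≋-trans (to , from) (to′ , from′) =
    (λ X dX → let (Y , dY , e) = to X dX ; (Z , dZ , e′) = to′ Y dY in Z , dZ , ≐-trans e e′)
  , (λ Z dZ → let (Y , dY , e′) = from′ Z dZ ; (X , dX , e) = from Y dY in X , dX , ≐-trans e e′)

module Meets {I ST : Set} (F : I → Family ST) where

  SameBlock : I → ST → ST → Set₁
  SameBlock i u v = ∃ λ X → F i X × X u × X v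

  Cell : (I → Set) → ST → ST → Set₁
  Cell P u v = ∀ i → P i → SameBlock i u v

  cell-mono : {P Q : I → Set} → (∀ i → P i → Q i) → ∀ {u v} → Cell Q u v → Cell P u v
  cell-mono P⊆Q c i p = c i (P⊆Q i p)

  cell-[_] : ∀ i {u} → Cell (_∈ˡ i ∷ []) u ≐ SameBlock i u
  cell-[ i ] v = (λ c → c i (here refl)) , (λ { h _ (here refl) → h })

  cell-∷ : ∀ {i is u} → Cell (_∈ˡ i ∷ is) u ≐ (SameBlock i u ∩ Cell (_∈ˡ is) u)
  cell-∷ {i} v = (λ c → c i (here refl) , λ j p → c j (there p))
               , (λ { (h , c) _ (here refl) → h ; (h , c) j (there p) → c j p })

  ⨀-nonempty : (∀ i X → F i X → NonEmpty X) →
               ∀ i is {Y} → ⨀ (F i) (map F is) Y → NonEmpty Y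
  ⨀-nonempty nonempty i []      d                                  = nonempty i _ d
  ⨀-nonempty nonempty i (_ ∷ _) (_ , _ , _ , _ , (u , x , y) , e) = u , proj₂ (e u) (x , y)

  ⨀-containing : ∀ {u} → (∀ i → ∃ λ X → F i X × X u) →
                 ∀ i is → ∃ λ Y → ⨀ (F i) (map F is) Y × Y u
  ⨀-containing cover i [] = cover i
  ⨀-containing {u} cover i (j ∷ js) =
    let (X , dX , xu) = cover i
        (Y , dY , yu) = ⨀-containing cover j js
    in  (X ∩ Y) , (X , Y , dX , dY , (u , xu , yu) , ≐-refl) , (xu , yu)

  module _ (clear : ∀ i X Y → F i X → F i Y → NonEmpty (X ∩ Y) → X ≐ Y) where

    block≐sameBlock : ∀ {i X u} → F i X → X u → X ≐ SameBlock i u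
    block≐sameBlock {i} {X} {u} dX xu v =
        (λ xv → X , dX , xu , xv)
      , (λ { (Z , dZ , zu , zv) → proj₂ (clear i X Z dX dZ (u , xu , zu) v) zv })

    ⨀≐cell : ∀ i is {Y u} → ⨀ (F i) (map F is) Y → Y u → Y ≐ Cell (_∈ˡ i ∷ is) u
    ⨀≐cell i []       dY yu = ≐-trans (block≐sameBlock dY yu) (≐-sym cell-[ i ])
    ⨀≐cell i (j ∷ js) {u = u} (_ , _ , dX , dZ , _ , e) yu =
      let (xu , zu) = proj₁ (e u) yu
      in  ≐-trans e (≐-trans (∩-cong (block≐sameBlock dX xu) (⨀≐cell j js dZ zu))
                             (≐-sym cell-∷))

∈-members⁺ : ∀ {n} (C : Subset n) {i} → i ∈ C → i ∈ˡ members C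
∈-members⁺ {n} C {i} = ∈-filter⁺ (_∈? C) {xs = allFin n} (∈-allFin i)

∈-members⁻ : ∀ {n} (C : Subset n) {i} → i ∈ˡ members C → i ∈ C
∈-members⁻ {n} C p = proj₂ (∈-filter⁻ (_∈? C) {xs = allFin n} p)

module Construction {k : ℕ} {ST AP : Set} (N : NbhdModel (suc k) ST AP) (clr : IsClearNM N) where
  open NbhdModel N
  open module Meetsₛ (s : ST) = Meets (λ b → nei b s)

  record Block : Set₁ where
    constructor block
    field
      agent  : Fin (suc k)
      state  : ST
      points : ST → Set
      isNei  : nei agent state points
  open Block

  -- nothing is a dummy action, only there to make AC nonempty; it is never available.
  Act : Set₁
  Act = Maybe Block

  _≈_ : Act → Act → Set
  nothing ≈ nothing = ⊤
  nothing ≈ just _  = ⊥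
  just _  ≈ nothing = ⊥
  just β  ≈ just γ  = agent β ≡ agent γ × state β ≡ state γ × points β ≐ points γ

  ≈-refl : ∀ {x} → x ≈ x
  ≈-refl {nothing} = tt
  ≈-refl {just _}  = refl , refl , ≐-refl

  ≈-sym : ∀ {x y} → x ≈ y → y ≈ x
  ≈-sym {nothing} {nothing} _             = tt
  ≈-sym {just _}  {just _}  (p , q , e) = sym p , sym q , ≐-sym e

  ≈-trans : ∀ {x y z} → x ≈ y → y ≈ z → x ≈ z
  ≈-trans {nothing} {nothing} {nothing} _ _ = tt
  ≈-trans {just _} {just _} {just _} (p , q , e) (p′ , q′ , e′) =
    trans p p′ , trans q q′ , ≐-trans e e′

  AC : Setoid (lsuc 0ℓ) 0ℓ
  AC = record { Carrier = Act ; _≈_ = _≈_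
              ; isEquivalence = record { refl = ≈-refl ; sym = ≈-sym ; trans = ≈-trans } }

  Valid : Fin (suc k) → ST → Act → ST → Set
  Valid b s nothing  u = ⊥
  Valid b s (just β) u = agent β ≡ b × state β ≡ s × points β u

  valid-resp : ∀ {b s x y u} → x ≈ y → Valid b s x u → Valid b s y u
  valid-resp {x = just _} {just _} (refl , refl , e) (refl , refl , xu) = refl , refl , proj₁ (e _) xu

  valid-unique : ∀ {b s x y u} → Valid b s x u → Valid b s y u → x ≈ y
  valid-unique {b} {s} {just (block _ _ X dX)} {just (block _ _ Y dY)} {u}
               (refl , refl , xu) (refl , refl , yu) =
    refl , refl , clr b s X Y dX dY (u , xu , yu)

  valid⇒sameBlock : ∀ {b s x u v} → Valid b s x u → Valid b s x v → SameBlock s b u v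
  valid⇒sameBlock {x = just (block _ _ X dX)} (refl , refl , xu) (refl , refl , xv) = X , dX , xu , xv

  valid-sameBlock : ∀ {b s x u v} → Valid b s x u → SameBlock s b u v → Valid b s x v
  valid-sameBlock {b} {s} {just (block _ _ X dX)} {u} {v} (refl , refl , xu) (Y , dY , yu , yv) =
    refl , refl , proj₂ (clr b s X Y dX dY (u , xu , yu) v) yv

  sameBlock⇒suc : ∀ {s b u v} → SameBlock s b u v → sucᴺ s v
  sameBlock⇒suc {s} {b} {v = v} (X , dX , _ , xv) = proj₁ (nei-union b s v) (X , dX , xv)

  blockContaining : ∀ {s u} → sucᴺ s u → ∀ b → ∃ λ X → nei b s X × X u
  blockContaining {s} {u} su b = let (X , dX , xu) = proj₂ (nei-union b s u) su in X , dX , xu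

  actionContaining : ∀ {s u} → sucᴺ s u → ∀ b → Σ Act λ x → Valid b s x u
  actionContaining {s} su b =
    let (X , dX , xu) = blockContaining su b in just (block b s X dX) , refl , refl , xu

  M : ActionModel (suc k) ST AP
  M = record
    { AC = AC
    ; st₀ = st₀
    ; act₀ = nothing
    ; outAG = λ s σ u → ∀ b → Valid b s (σ b) u
    ; outAG-resp = λ s σ σ′ e u → (λ o b → valid-resp (e b) (o b))
                                 , (λ o b → valid-resp (≈-sym (e b)) (o b))
    ; L = L
    }
  open ActionModel M using (JA; outC; AE)

  M-clear : IsClearAM M
  M-clear s σ σ′ σ≉σ′ (u , o , o′) = σ≉σ′ (λ b → valid-unique (o b) (o′ b))

  coalitionCell : Subset (suc k) → ST → ST → ST → Set₁
  coalitionCell C s u = sucᴺ s ∩ Cell s (_∈ C) u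

  Cells : Subset (suc k) → ST → (ST → Set₁) → Set₁
  Cells C s Y = ∃ λ u → sucᴺ s u × Y ≐ coalitionCell C s u

  -- Uses an agent (here zero): with no agents out_AG(s, σ) would be all of ST.
  outC⇒suc : ∀ {C s σC u} → outC C s σC u → sucᴺ s u
  outC⇒suc (_ , _ , o) = sameBlock⇒suc (valid⇒sameBlock (o zero) (o zero))

  outC≐cell : ∀ {C s σC u} → outC C s σC u → outC C s σC ≐ coalitionCell C s u
  outC≐cell {C} {s} {σC} {u} (σ₀ , σC⊑σ₀ , o₀) v = into , outof
    where
    into : outC C s σC v → coalitionCell C s u v
    into ov@(σ , σC⊑σ , o) = outC⇒suc ov , λ b q →
      valid⇒sameBlock (o₀ b) (valid-resp (≈-trans (≈-sym (σC⊑σ b q)) (σC⊑σ₀ b q)) (o b))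

    outof : coalitionCell C s u v → outC C s σC v
    outof (sv , cell) = σ , σC⊑σ , valid
      where
      σ : Fin (suc k) → Act
      σ b with b ∈? C
      ... | yes _ = σ₀ b
      ... | no  _ = proj₁ (actionContaining sv b)

      σC⊑σ : ∀ b q → σC b q ≈ σ b
      σC⊑σ b q with b ∈? C
      ... | yes _ = σC⊑σ₀ b q
      ... | no  b∉C = ⊥-elim (b∉C q)

      valid : ∀ b → Valid b s (σ b) v
      valid b with b ∈? C
      ... | yes q = valid-sameBlock (o₀ b) (cell b q)
      ... | no  _ = proj₂ (actionContaining sv b)

  AE≋cells : ∀ C s → AE C s ≋ Cells C s
  AE≋cells C s = to , from
    where
    to : ∀ X → AE C s X → ∃ λ Y → Cells C s Y × X ≐ Y
    to X (σC , (u , ou) , e) = coalitionCell C s u , (u , outC⇒suc ou , ≐-refl) , ≐-trans e (outC≐cell ou)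

    from : ∀ Y → Cells C s Y → ∃ λ X → AE C s X × X ≐ Y
    from Y (u , su , e) = outC C s σC , (σC , (u , ou) , ≐-refl) , ≐-trans (outC≐cell ou) (≐-sym e)
      where
      σ : Fin (suc k) → Act
      σ b = proj₁ (actionContaining su b)

      σC : JA C
      σC b _ = σ b

      ou : outC C s σC u
      ou = σ , (λ b _ → ≈-refl {σ b}) , (λ b → proj₂ (actionContaining su b))

  neiCoal≋cells : ∀ C s → neiCoal C s ≋ Cells C s
  neiCoal≋cells C s with members C | ∈-members⁺ C | ∈-members⁻ C
  ... | [] | toL | _ = to , from
    where
    suc≐cell : ∀ {u} → sucᴺ s ≐ coalitionCell C s u
    suc≐cell v = (λ sv → sv , λ b q → ⊥-elim (¬Any[] (toL q))) , proj₁

    to : ∀ Y → Lift _ (NonEmpty (sucᴺ s) × Y ≐ sucᴺ s) → ∃ λ Y′ → Cells C s Y′ × Y ≐ Y′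
    to Y (lift ((u , su) , e)) = coalitionCell C s u , (u , su , ≐-refl) , ≐-trans e suc≐cell

    from : ∀ Y′ → Cells C s Y′ → ∃ λ Y → Lift _ (NonEmpty (sucᴺ s) × Y ≐ sucᴺ s) × Y ≐ Y′
    from Y′ (u , su , e) = sucᴺ s , lift ((u , su) , ≐-refl) , ≐-trans suc≐cell (≐-sym e)
  ... | a ∷ as | toL | fromL = to , from
    where
    listCell≐cell : ∀ {u} → Cell s (_∈ˡ a ∷ as) u ≐ coalitionCell C s u
    listCell≐cell v = (λ c → sameBlock⇒suc (c a (here refl)) , cell-mono s (λ _ → toL) c)
                    , (λ { (_ , c) → cell-mono s (λ _ → fromL) c })

    to : ∀ Y → NonEmpty (sucᴺ s) × ⨀ (nei a s) (map (λ b → nei b s) as) Y → ∃ λ Y′ → Cells C s Y′ × Y ≐ Y′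
    to Y (_ , dY) =
      let (u , yu) = ⨀-nonempty s (λ b → nei-nonempty b s) a as dY
          e = ≐-trans (⨀≐cell s (λ b → clr b s) a as dY yu) listCell≐cell
      in  coalitionCell C s u , (u , proj₁ (proj₁ (e u) yu) , ≐-refl) , e

    from : ∀ Y′ → Cells C s Y′ →
           ∃ λ Y → (NonEmpty (sucᴺ s) × ⨀ (nei a s) (map (λ b → nei b s) as) Y) × Y ≐ Y′
    from Y′ (u , su , e) =
      let (Y , dY , yu) = ⨀-containing s (blockContaining su) a as
      in  Y , ((u , su) , dY)
            , ≐-trans (⨀≐cell s (λ b → clr b s) a as dY yu) (≐-trans listCell≐cell (≐-sym e))

  M-zrepresented : ZRepresents N M
  M-zrepresented = refl , λ C s → ≋-trans (AE≋cells C s) (≋-sym (neiCoal≋cells C s))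

theorem5p8 : {k : ℕ} {ST AP : Set} (N : NbhdModel (suc k) ST AP) → IsClearNM N →
    Σ (ActionModel (suc k) ST AP) (λ M → IsClearAM M × ZRepresents N M)
theorem5p8 N clr = M , M-clear , M-zrepresented
  where open Construction N clr
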